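{- Let $G$ be a polygonal 2-tree with $n$ vertices and $m$ edges. Then the number of induced cycles of $G$ is $m - n + 1$.
   Context: All graphs are finite, simple, undirected and unweighted. A polygonal 2-tree is defined recursively: every cycle is a polygonal 2-tree; if $G$ is a polygonal 2-tree and $(u,v) \in E(G)$, then adding a new path $P$ between $u$ and $v$ with $E(G) \cap E(P) = \emptyset$, $V(G) \cap V(P) = \{u,v\}$ and $|E(P)| \geq 2$ yields a polygonal 2-tree. An induced cycle is a chordless cycle. -}

module Defs where

open import Data.Nat using (ℕ; zero; suc; _+_; _≤_; _≡ᵇ_; _<ᵇ_)
open import Data.Bool using (Bool; true; false; _∧_; _∨_; if_then_else_)
open import Data.Fin using (Fin; toℕ; splitAt)
open import Data.Fin.Subset using (Subset; _∈_; ⊤)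
open import Data.List using (List; length; map; allFin)
open import Data.Nat.ListAction using (sum)
open import Data.List.Relation.Unary.All using (All)
open import Data.List.Relation.Unary.Unique.Propositional using (Unique)
import Data.List.Membership.Propositional as LM
open import Data.Sum using (_⊎_; inj₁; inj₂)
open import Data.Product using (Σ; _×_; ∃)
open import Function.Bundles using (_⇔_; _↔_; Inverse)
open import Function.Definitions using (Injective)
open import Relation.Binary.PropositionalEquality using (_≡_)

-- A graph on the vertex set Fin n, given by a Boolean adjacency matrix.
-- (Simplicity -- symmetry, irreflexivity -- is guaranteed for all polygonal
-- 2-trees below by construction.)
Graph : ℕ → Set
Graph n = Fin n → Fin n → Bool

Adj : ∀ {n} → Graph n → Fin n → Fin n → Set
Adj G x y = G x y ≡ true

edgeCount : ∀ {n} → Graph n → ℕ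
edgeCount {n} G =
  sum (map (λ i → sum (map (λ j → if (toℕ i <ᵇ toℕ j) ∧ G i j then 1 else 0)
                            (allFin n)))
           (allFin n))

CycAdj : (k : ℕ) → Fin k → Fin k → Set
CycAdj k i j =
  (suc (toℕ i) ≡ toℕ j) ⊎ (suc (toℕ j) ≡ toℕ i)
  ⊎ ((suc (toℕ i) ≡ k) × (toℕ j ≡ 0)) ⊎ ((suc (toℕ j) ≡ k) × (toℕ i ≡ 0))

IsInducedCycle : ∀ {n} → Graph n → Subset n → Set
IsInducedCycle {n} G S =
  Σ ℕ λ k → (3 ≤ k) × Σ (Fin k → Fin n) λ f →
    Injective _≡_ _≡_ f
    × (∀ x → (x ∈ S) ⇔ (∃ λ i → f i ≡ x))
    × (∀ i j → Adj G (f i) (f j) ⇔ CycAdj k i j)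

IsCycleGraph : ∀ {n} → Graph n → Set
IsCycleGraph G = IsInducedCycle G ⊤

_≅_ : ∀ {n} → Graph n → Graph n → Set
_≅_ {n} G H = Σ (Fin n ↔ Fin n) λ σ →
  ∀ i j → H (Inverse.to σ i) (Inverse.to σ j) ≡ G i j

-- Adding a new path u - w₀ - w₁ - ... - w_p - v of length p + 2 (≥ 2 edges)
-- with p + 1 new internal vertices; old vertices keep their labels
-- (Fin n ⊆ Fin (n + suc p) via inject+), new vertex w_k is raise n k.
addPath : ∀ {n} → Graph n → Fin n → Fin n → (p : ℕ) → Graph (n + suc p)
addPath {n} G u v p x y = go (splitAt n x) (splitAt n y)
  where
  eqF : Fin n → Fin n → Bool
  eqF a b = toℕ a ≡ᵇ toℕ b
  att : Fin n → Fin (suc p) → Bool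
  att a k = (eqF a u ∧ (toℕ k ≡ᵇ 0)) ∨ (eqF a v ∧ (toℕ k ≡ᵇ p))
  go : Fin n ⊎ Fin (suc p) → Fin n ⊎ Fin (suc p) → Bool
  go (inj₁ a) (inj₁ b) = G a b
  go (inj₁ a) (inj₂ k) = att a k
  go (inj₂ k) (inj₁ a) = att a k
  go (inj₂ k) (inj₂ l) = (suc (toℕ k) ≡ᵇ toℕ l) ∨ (suc (toℕ l) ≡ᵇ toℕ k)

data Polygonal2Tree : ∀ {n} → Graph n → Set where
  cycle : ∀ {n} (G : Graph n) → IsCycleGraph G → Polygonal2Tree G
  path  : ∀ {n} (G : Graph n) (u v : Fin n) (p : ℕ) →
          Polygonal2Tree G → Adj G u v → Polygonal2Tree (addPath G u v p)
  iso   : ∀ {n} (G H : Graph n) → Polygonal2Tree G → G ≅ H → Polygonal2Tree H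

-- G has exactly c induced cycles: there is a duplicate-free list of the
-- vertex sets of all induced cycles, of length c.
-- (In a simple graph an induced cycle is determined by its vertex set.)
NumInducedCycles : ∀ {n} → Graph n → ℕ → Set
NumInducedCycles {n} G c =
  Σ (List (Subset n)) λ L →
    Unique L × All (IsInducedCycle G) L
    × (∀ S → IsInducedCycle G S → S LM.∈ L) × (length L ≡ c)

-- The induction along the construction carries the identity m + 1 = n + c, with c the
-- number of induced cycles.  A cycle has as many edges as vertices (its degree sum is 2n)
-- and a single induced cycle, since an induced cycle inside another one equals it.
-- Gluing a path with p + 1 new interior vertices onto an edge uv adds p + 2 edges and
-- exactly one induced cycle, the path closed up by uv: new vertices have degree two, so an
-- induced cycle through one of them contains its neighbours, hence the whole closed path,
-- and then equals it; an induced cycle avoiding the new vertices is one of the old graph.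
-- Edge counts are compared through degree sums, which are twice the edge counts.

module Submission where

open import Defs
open import Data.Nat
  using (ℕ; zero; suc; _+_; _*_; _∸_; _⊓_; _≤_; _<_; _≤?_; _<?_; _≡ᵇ_; _<ᵇ_; s≤s; z≤n)
open import Data.Nat.Properties hiding (_≟_)
open import Data.Nat.Solver using (module +-*-Solver)
open import Data.Bool using (Bool; true; false; T; _∧_; _∨_; if_then_else_)
open import Data.Bool.Properties using (∨-comm; ∨-identityʳ; ∨-zeroʳ; T-≡; T-∧; T-∨)
open import Data.Fin using (Fin; zero; suc; toℕ; fromℕ; fromℕ<; inject₁; splitAt; _↑ˡ_; _↑ʳ_)
open import Data.Fin.Properties
  using (toℕ-injective; toℕ<n; toℕ-fromℕ<; toℕ-fromℕ; toℕ-inject₁; splitAt-↑ˡ; splitAt-↑ʳ;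
         splitAt⁻¹-↑ˡ; splitAt⁻¹-↑ʳ; toℕ-↑ˡ; toℕ-↑ʳ; ↑ˡ-injective; ↑ʳ-injective;
         _≟_; any?)
open import Data.Fin.Permutation using (Permutation; _⟨$⟩ʳ_; _⟨$⟩ˡ_; inverseˡ; inverseʳ)
open import Data.Fin.Subset using (Subset; _∈_; _⊆_; ⊤)
open import Data.Fin.Subset.Properties using (∈⊤; _∈?_; ⊆-antisym)
open import Data.Vec using (lookup; tabulate)
open import Data.Vec.Properties using (lookup∘tabulate; []=⇒lookup; lookup⇒[]=)
open import Data.List using ([]; _∷_; map; allFin)
import Data.List as List using (tabulate)
import Data.List.Properties as List
import Data.Nat.ListAction as ListAction
open import Data.List.Properties using (length-map)
open import Data.List.Relation.Unary.All as All using ([]; _∷_)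
import Data.List.Relation.Unary.All.Properties as All
open import Data.List.Relation.Unary.Any using (here; there)
open import Data.List.Relation.Unary.AllPairs using ([]; _∷_)
open import Data.List.Relation.Unary.Unique.Propositional using (Unique)
import Data.List.Relation.Unary.Unique.Propositional.Properties as Unique
import Data.List.Membership.Propositional as List
import Data.List.Membership.Propositional.Properties as List
open import Data.Sum using (_⊎_; inj₁; inj₂; [_,_]′)
open import Data.Product using (Σ; _×_; _,_; proj₁; proj₂; ∃)
open import Data.Empty using (⊥-elim)
open import Function using (_∘_; id)
open import Function.Bundles using (Equivalence; _⇔_; mk⇔; mk↔ₛ′)
open import Function.Definitions using (Injective)
open import Relation.Binary.PropositionalEquality
open import Relation.Binary.Definitions using (tri<; tri≈; tri>)
open import Relation.Nullary using (¬_; Dec; yes; no; does; _×-dec_)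
open import Relation.Nullary.Decidable using (dec-true)
open import Algebra.Properties.CommutativeMonoid.Sum +-0-commutativeMonoid
  using (sum-syntax; sum-cong-≗; sum-replicate-zero; ∑-distrib-+; ∑-comm; ∑-permute)

open Equivalence using (to; from)

𝟙 : Bool → ℕ
𝟙 b = if b then 1 else 0

≡ᵇ-true⇒≡ : ∀ {x y} → (x ≡ᵇ y) ≡ true → x ≡ y
≡ᵇ-true⇒≡ {x} {y} e = ≡ᵇ⇒≡ x y (from T-≡ e)

≡⇒≡ᵇ-true : ∀ {x y} → x ≡ y → (x ≡ᵇ y) ≡ true
≡⇒≡ᵇ-true {x} {y} e = to T-≡ (≡⇒≡ᵇ x y e)

≢⇒≡ᵇ-false : ∀ {x y} → x ≢ y → (x ≡ᵇ y) ≡ false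
≢⇒≡ᵇ-false {x} {y} x≢y with x ≡ᵇ y in e
... | true  = ⊥-elim (x≢y (≡ᵇ-true⇒≡ e))
... | false = refl

∑-const : ∀ k c → ∑[ i < k ] c ≡ k * c
∑-const zero    c = refl
∑-const (suc k) c = cong (c +_) (∑-const k c)

∑-↑ : ∀ m n (f : Fin (m + n) → ℕ) →
      ∑[ x < m + n ] f x ≡ ∑[ a < m ] f (a ↑ˡ n) + ∑[ k < n ] f (m ↑ʳ k)
∑-↑ zero    n f = refl
∑-↑ (suc m) n f = trans (cong (f zero +_) (∑-↑ m n (f ∘ suc))) (sym (+-assoc (f zero) _ _))

∑-𝟙-toℕ-≡ᵇ : ∀ {m} (a : Fin m) → ∑[ j < m ] 𝟙 (toℕ j ≡ᵇ toℕ a) ≡ 1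
∑-𝟙-toℕ-≡ᵇ {suc m} zero    = cong suc (sum-replicate-zero m)
∑-𝟙-toℕ-≡ᵇ {suc m} (suc a) = ∑-𝟙-toℕ-≡ᵇ a

∑-𝟙-≡ᵇ-toℕ : ∀ x m → ∑[ l < m ] 𝟙 (x ≡ᵇ toℕ l) ≡ 𝟙 (x <ᵇ m)
∑-𝟙-≡ᵇ-toℕ x       zero    = refl
∑-𝟙-≡ᵇ-toℕ zero    (suc m) = cong suc (sum-replicate-zero m)
∑-𝟙-≡ᵇ-toℕ (suc x) (suc m) = ∑-𝟙-≡ᵇ-toℕ x m

∑-𝟙-<ᵇ : ∀ m q → ∑[ k < m ] 𝟙 (toℕ k <ᵇ q) ≡ m ⊓ q
∑-𝟙-<ᵇ zero    q       = refl
∑-𝟙-<ᵇ (suc m) zero    = sum-replicate-zero m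
∑-𝟙-<ᵇ (suc m) (suc q) = cong suc (∑-𝟙-<ᵇ m q)

∑-𝟙-two-witnesses : ∀ {m} (P : Fin m → Bool) (a b : Fin m) → a ≢ b →
  (∀ j → P j ≡ true → j ≡ a ⊎ j ≡ b) → P a ≡ true → P b ≡ true →
  ∑[ j < m ] 𝟙 (P j) ≡ 2
∑-𝟙-two-witnesses {m} P a b a≢b only-a-b Pa Pb =
  trans (sum-cong-≗ by-witness)
        (trans (∑-distrib-+ (λ j → 𝟙 (j ≟ᵇ a)) (λ j → 𝟙 (j ≟ᵇ b))) (cong₂ _+_ (∑-𝟙-toℕ-≡ᵇ a) (∑-𝟙-toℕ-≡ᵇ b)))
  where
  _≟ᵇ_ : Fin m → Fin m → Bool
  i ≟ᵇ j = toℕ i ≡ᵇ toℕ j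
  ≟ᵇ-false : ∀ {i j} → i ≢ j → (i ≟ᵇ j) ≡ false
  ≟ᵇ-false i≢j = ≢⇒≡ᵇ-false (i≢j ∘ toℕ-injective)
  ≢-witness : ∀ {j x} → P x ≡ true → P j ≡ false → j ≢ x
  ≢-witness Px Pj refl with trans (sym Px) Pj
  ... | ()
  by-witness : ∀ j → 𝟙 (P j) ≡ 𝟙 (j ≟ᵇ a) + 𝟙 (j ≟ᵇ b)
  by-witness j with P j in Pj
  ... | false rewrite ≟ᵇ-false (≢-witness Pa Pj) | ≟ᵇ-false (≢-witness Pb Pj) = refl
  ... | true with only-a-b j Pj
  ...   | inj₁ refl rewrite ≡⇒≡ᵇ-true (refl {x = toℕ a}) | ≟ᵇ-false a≢b = refl
  ...   | inj₂ refl rewrite ≡⇒≡ᵇ-true (refl {x = toℕ b}) | ≟ᵇ-false (a≢b ∘ sym) = refl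

-- Degree sums

Undirected : ∀ {n} → Graph n → Set
Undirected G = ∀ x y → G x y ≡ G y x

Loopless : ∀ {n} → Graph n → Set
Loopless G = ∀ x → G x x ≡ false

degreeSum : ∀ {n} → Graph n → ℕ
degreeSum {n} G = ∑[ i < n ] ∑[ j < n ] 𝟙 (G i j)

listSum≡∑ : ∀ n (f : Fin n → ℕ) → ListAction.sum (map f (allFin n)) ≡ ∑[ i < n ] f i
listSum≡∑ n f = trans (cong ListAction.sum (List.map-tabulate id f)) (tabulate-sum n f)
  where
  tabulate-sum : ∀ n (f : Fin n → ℕ) → ListAction.sum (List.tabulate f) ≡ ∑[ i < n ] f i
  tabulate-sum zero    f = refl
  tabulate-sum (suc n) f = cong (f zero +_) (tabulate-sum n (f ∘ suc))

edgeCount≡∑ : ∀ {n} (G : Graph n) →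
              edgeCount G ≡ ∑[ i < n ] ∑[ j < n ] 𝟙 ((toℕ i <ᵇ toℕ j) ∧ G i j)
edgeCount≡∑ {n} G =
  trans (cong ListAction.sum (List.map-cong (λ i → listSum≡∑ n _) (allFin n))) (listSum≡∑ n _)

𝟙-split-by-order : ∀ {n} (G : Graph n) → Loopless G → ∀ i j →
  𝟙 (G i j) ≡ 𝟙 ((toℕ i <ᵇ toℕ j) ∧ G i j) + 𝟙 ((toℕ j <ᵇ toℕ i) ∧ G i j)
𝟙-split-by-order G loopless i j with toℕ i <ᵇ toℕ j in i<j | toℕ j <ᵇ toℕ i in j<i
... | true  | true  =
  ⊥-elim (<-asym (<ᵇ⇒< (toℕ i) (toℕ j) (from T-≡ i<j)) (<ᵇ⇒< (toℕ j) (toℕ i) (from T-≡ j<i)))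
... | true  | false = sym (+-identityʳ _)
... | false | true  = refl
... | false | false with <-cmp (toℕ i) (toℕ j)
...   | tri< lt _ _ = ⊥-elim (subst T i<j (<⇒<ᵇ lt))
...   | tri> _ _ gt = ⊥-elim (subst T j<i (<⇒<ᵇ gt))
...   | tri≈ _ eq _ rewrite toℕ-injective eq = cong 𝟙 (loopless j)

handshake : ∀ {n} (G : Graph n) → Undirected G → Loopless G →
            degreeSum G ≡ edgeCount G + edgeCount G
handshake {n} G undirected loopless = begin
  degreeSum G
    ≡⟨ sum-cong-≗ (λ i → trans (sum-cong-≗ (𝟙-split-by-order G loopless i))
                               (∑-distrib-+ (𝟙 ∘ above i) (𝟙 ∘ below i))) ⟩
  ∑[ i < n ] (∑[ j < n ] 𝟙 (above i j) + ∑[ j < n ] 𝟙 (below i j))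
    ≡⟨ ∑-distrib-+ (λ i → ∑[ j < n ] 𝟙 (above i j)) (λ i → ∑[ j < n ] 𝟙 (below i j)) ⟩
  upper + ∑[ i < n ] ∑[ j < n ] 𝟙 (below i j)
    ≡⟨ cong (upper +_) (∑-comm (λ i j → 𝟙 (below i j))) ⟩
  upper + ∑[ j < n ] ∑[ i < n ] 𝟙 (below i j)
    ≡⟨ cong (upper +_) (sum-cong-≗ λ j → sum-cong-≗ λ i →
         cong (λ b → 𝟙 ((toℕ j <ᵇ toℕ i) ∧ b)) (undirected i j)) ⟩
  upper + upper
    ≡⟨ sym (cong₂ _+_ (edgeCount≡∑ G) (edgeCount≡∑ G)) ⟩
  edgeCount G + edgeCount G ∎
  where
  open ≡-Reasoning
  above below : Fin n → Fin n → Bool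
  above i j = (toℕ i <ᵇ toℕ j) ∧ G i j
  below i j = (toℕ j <ᵇ toℕ i) ∧ G i j
  upper : ℕ
  upper = ∑[ i < n ] ∑[ j < n ] 𝟙 (above i j)

edgeCount-from-degreeSum : ∀ {n} (G : Graph n) → Undirected G → Loopless G →
                           ∀ {d} → degreeSum G ≡ d + d → edgeCount G ≡ d
edgeCount-from-degreeSum G undirected loopless {d} e =
  *-cancelˡ-≡ (edgeCount G) d 2 (begin
    2 * edgeCount G           ≡⟨ cong (edgeCount G +_) (+-identityʳ _) ⟩
    edgeCount G + edgeCount G ≡⟨ sym (handshake G undirected loopless) ⟩
    degreeSum G               ≡⟨ e ⟩
    d + d                     ≡⟨ cong (d +_) (sym (+-identityʳ d)) ⟩
    2 * d                     ∎)
  where open ≡-Reasoning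

degreeSum-permute : ∀ {k n} (G : Graph n) (π : Permutation k n) →
                    degreeSum G ≡ ∑[ i < k ] ∑[ j < k ] 𝟙 (G (π ⟨$⟩ʳ i) (π ⟨$⟩ʳ j))
degreeSum-permute {k} {n} G π =
  trans (∑-permute (λ x → ∑[ y < n ] 𝟙 (G x y)) π)
        (sum-cong-≗ (λ i → ∑-permute (λ y → 𝟙 (G (π ⟨$⟩ʳ i) y)) π))

-- The cyclic order on Fin k

Succ : (k : ℕ) → Fin k → Fin k → Set
Succ k i j = (suc (toℕ i) ≡ toℕ j) ⊎ ((suc (toℕ i) ≡ k) × (toℕ j ≡ 0))

CycAdj⇒Succ : ∀ {k i j} → CycAdj k i j → Succ k i j ⊎ Succ k j i
CycAdj⇒Succ (inj₁ i→j)               = inj₁ (inj₁ i→j)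
CycAdj⇒Succ (inj₂ (inj₁ j→i))        = inj₂ (inj₁ j→i)
CycAdj⇒Succ (inj₂ (inj₂ (inj₁ i→j))) = inj₁ (inj₂ i→j)
CycAdj⇒Succ (inj₂ (inj₂ (inj₂ j→i))) = inj₂ (inj₂ j→i)

Succ⇒CycAdj : ∀ {k i j} → Succ k i j ⊎ Succ k j i → CycAdj k i j
Succ⇒CycAdj (inj₁ (inj₁ i→j)) = inj₁ i→j
Succ⇒CycAdj (inj₂ (inj₁ j→i)) = inj₂ (inj₁ j→i)
Succ⇒CycAdj (inj₁ (inj₂ i→j)) = inj₂ (inj₂ (inj₁ i→j))
Succ⇒CycAdj (inj₂ (inj₂ j→i)) = inj₂ (inj₂ (inj₂ j→i))

CycAdj-sym : ∀ {k} {i j : Fin k} → CycAdj k i j → CycAdj k j i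
CycAdj-sym adj with CycAdj⇒Succ adj
... | inj₁ i→j = Succ⇒CycAdj (inj₂ i→j)
... | inj₂ j→i = Succ⇒CycAdj (inj₁ j→i)

next : ∀ {k} → Fin k → Fin k
next {suc k} i with suc (toℕ i) <? suc k
... | yes i+1<k = fromℕ< i+1<k
... | no _      = zero

prev : ∀ {k} → Fin k → Fin k
prev {suc k} zero    = fromℕ k
prev {suc k} (suc i) = inject₁ i

Succ-next : ∀ {k} (i : Fin k) → Succ k i (next i)
Succ-next {suc k} i with suc (toℕ i) <? suc k
... | yes i+1<k = inj₁ (sym (toℕ-fromℕ< i+1<k))
... | no  i+1≮k = inj₂ (≤-antisym (toℕ<n i) (≮⇒≥ i+1≮k) , refl)

Succ-prev : ∀ {k} (i : Fin k) → Succ k (prev i) i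
Succ-prev {suc k} zero    = inj₂ (cong suc (toℕ-fromℕ k) , refl)
Succ-prev {suc k} (suc i) = inj₁ (cong suc (toℕ-inject₁ i))

Succ-functional : ∀ {k i j j′} → Succ k i j → Succ k i j′ → j ≡ j′
Succ-functional (inj₁ i→j) (inj₁ i→j′) = toℕ-injective (trans (sym i→j) i→j′)
Succ-functional {j = j} (inj₁ i→j) (inj₂ (i+1≡k , _)) =
  ⊥-elim (<-irrefl (trans (sym i→j) i+1≡k) (toℕ<n j))
Succ-functional {j′ = j′} (inj₂ (i+1≡k , _)) (inj₁ i→j′) =
  ⊥-elim (<-irrefl (trans (sym i→j′) i+1≡k) (toℕ<n j′))
Succ-functional (inj₂ (_ , j≡0)) (inj₂ (_ , j′≡0)) = toℕ-injective (trans j≡0 (sym j′≡0))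

Succ-injective : ∀ {k i i′ j} → Succ k i j → Succ k i′ j → i ≡ i′
Succ-injective (inj₁ i→j) (inj₁ i′→j) = toℕ-injective (suc-injective (trans i→j (sym i′→j)))
Succ-injective (inj₁ i→j) (inj₂ (_ , j≡0)) with trans i→j j≡0
... | ()
Succ-injective (inj₂ (_ , j≡0)) (inj₁ i′→j) with trans i′→j j≡0
... | ()
Succ-injective (inj₂ (i+1≡k , _)) (inj₂ (i′+1≡k , _)) =
  toℕ-injective (suc-injective (trans i+1≡k (sym i′+1≡k)))

Succ-asym : ∀ {k} {i j : Fin k} → 3 ≤ k → Succ k i j → ¬ Succ k j i
Succ-asym 3≤k = asym 3≤k
  where
  asym : ∀ {k x y} → 3 ≤ k →
         (suc x ≡ y) ⊎ ((suc x ≡ k) × (y ≡ 0)) → ¬ ((suc y ≡ x) ⊎ ((suc y ≡ k) × (x ≡ 0)))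
  asym _ (inj₁ refl) (inj₁ x+2≡x) = <-irrefl (sym x+2≡x) (m≤n⇒m≤1+n (n<1+n _))
  asym (s≤s (s≤s ())) (inj₁ refl) (inj₂ (refl , refl))
  asym (s≤s (s≤s ())) (inj₂ (refl , refl)) (inj₁ refl)

next≢prev : ∀ {k} → 3 ≤ k → (i : Fin k) → next i ≢ prev i
next≢prev 3≤k i e = Succ-asym 3≤k (Succ-next i) (subst (λ j → Succ _ j i) (sym e) (Succ-prev i))

CycAdj-irrefl : ∀ {k} {i : Fin k} → 3 ≤ k → ¬ CycAdj k i i
CycAdj-irrefl 3≤k adj with CycAdj⇒Succ adj
... | inj₁ i→i = Succ-asym 3≤k i→i i→i
... | inj₂ i→i = Succ-asym 3≤k i→i i→i

CycAdj-next : ∀ {k} (i : Fin k) → CycAdj k i (next i)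
CycAdj-next i = Succ⇒CycAdj (inj₁ (Succ-next i))

CycAdj-prev : ∀ {k} (i : Fin k) → CycAdj k i (prev i)
CycAdj-prev i = Succ⇒CycAdj (inj₂ (Succ-prev i))

CycAdj⇒next⊎prev : ∀ {k} {i j : Fin k} → CycAdj k i j → j ≡ next i ⊎ j ≡ prev i
CycAdj⇒next⊎prev {i = i} adj with CycAdj⇒Succ adj
... | inj₁ i→j = inj₁ (Succ-functional i→j (Succ-next i))
... | inj₂ j→i = inj₂ (Succ-injective j→i (Succ-prev i))

next-induction : ∀ {k} (Q : Fin k → Set) → (∀ i → Q i → Q (next i)) →
                 ∀ i₀ → Q i₀ → ∀ i → Q i
next-induction {suc k} Q step i₀ Qi₀ i = forward zero Qzero (toℕ i) i refl
  where
  forward : ∀ j → Q j → ∀ d i → toℕ i ≡ toℕ j + d → Q i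
  forward j Qj zero    i i≡j = subst Q (toℕ-injective (sym (trans i≡j (+-identityʳ _)))) Qj
  forward j Qj (suc d) i i≡j+d+1 with Succ-prev i
  ... | inj₁ i-1→i = subst Q (Succ-functional (Succ-next (prev i)) (Succ-prev i))
                       (step (prev i) (forward j Qj d (prev i)
                         (suc-injective (trans i-1→i (trans i≡j+d+1 (+-suc _ d))))))
  ... | inj₂ (_ , i≡0) = ⊥-elim (1+n≢0 (trans (sym (+-suc (toℕ j) d)) (trans (sym i≡j+d+1) i≡0)))
  last : Fin (suc k)
  last = fromℕ k
  Qlast : Q last
  Qlast = forward i₀ Qi₀ (k ∸ toℕ i₀) last
            (trans (toℕ-fromℕ k) (sym (m+[n∸m]≡n (≤-pred (toℕ<n i₀)))))
  Qzero : Q zero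
  Qzero = subst Q (Succ-functional (Succ-next last) (inj₂ (cong suc (toℕ-fromℕ k) , refl)))
                (step last Qlast)

-- Q propagates both ways from positions below b; the two remaining positions b and b + 1
-- are reached forwards from b − 1 and backwards from 0.
arc-induction : ∀ {b} (Q : Fin (b + 2) → Set) →
  (∀ t → toℕ t < b → Q t → Q (next t) × Q (prev t)) →
  ∀ t₀ → toℕ t₀ < b → Q t₀ → ∀ t → Q t
arc-induction {b} Q step t₀ t₀<b Qt₀ = everywhere
  where
  backward : ∀ d t → toℕ t + d ≡ toℕ t₀ → Q t
  backward zero    t e = subst Q (toℕ-injective (sym (trans (sym (+-identityʳ _)) e))) Qt₀
  backward (suc d) t e with Succ-next t
  ... | inj₁ t→ = subst Q (Succ-injective (Succ-prev (next t)) (Succ-next t))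
                    (proj₂ (step (next t) (≤-<-trans (≤-trans (m≤m+n _ d) (≤-reflexive e′)) t₀<b)
                                 (backward d (next t) e′)))
    where
    e′ : toℕ (next t) + d ≡ toℕ t₀
    e′ = trans (cong (_+ d) (sym t→)) (trans (sym (+-suc _ d)) e)
  ... | inj₂ (t+1≡b+2 , _) = ⊥-elim (<-irrefl t+1≡b+2 (begin-strict
    suc (toℕ t)  ≤⟨ ≤-trans (m≤m+n _ d) (≤-reflexive (trans (sym (+-suc _ d)) e)) ⟩
    toℕ t₀       <⟨ t₀<b ⟩
    b            <⟨ m<m+n b (s≤s z≤n) ⟩
    b + 2        ∎))
    where open ≤-Reasoning

  forward : ∀ d t → toℕ t ≡ toℕ t₀ + d → toℕ t ≤ b → Q t
  forward zero    t e _ = subst Q (toℕ-injective (sym (trans e (+-identityʳ _)))) Qt₀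
  forward (suc d) t e t≤b with Succ-prev t
  ... | inj₁ →t = subst Q (Succ-functional (Succ-next (prev t)) (Succ-prev t))
                    (proj₁ (step (prev t) prev<b (forward d (prev t) e′ (<⇒≤ prev<b))))
    where
    e′ : toℕ (prev t) ≡ toℕ t₀ + d
    e′ = suc-injective (trans →t (trans e (+-suc _ d)))
    prev<b : toℕ (prev t) < b
    prev<b = subst (_≤ b) (sym →t) t≤b
  ... | inj₂ (_ , t≡0) = ⊥-elim (1+n≢0 (trans (sym (+-suc (toℕ t₀) d)) (trans (sym e) t≡0)))

  everywhere : ∀ t → Q t
  everywhere t with toℕ t ≤? toℕ t₀ | toℕ t ≤? b
  ... | yes t≤t₀ | _      = backward (toℕ t₀ ∸ toℕ t) t (m+[n∸m]≡n t≤t₀)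
  ... | no  t≰t₀ | yes t≤b =
    forward (toℕ t ∸ toℕ t₀) t (sym (m+[n∸m]≡n (<⇒≤ (≰⇒> t≰t₀)))) t≤b
  ... | no  _    | no  t≰b with Succ-next t
  ...   | inj₁ t→ = ⊥-elim (t≰b (≤-pred (≤-pred (begin
          suc (suc (toℕ t)) ≡⟨ cong suc t→ ⟩
          suc (toℕ (next t)) ≤⟨ toℕ<n (next t) ⟩
          b + 2              ≡⟨ +-comm b 2 ⟩
          suc (suc b)        ∎))))
    where open ≤-Reasoning
  ...   | inj₂ (_ , next≡0) = subst Q (Succ-injective (Succ-prev (next t)) (Succ-next t))
          (proj₂ (step (next t) (subst (_< b) (sym next≡0) (≤-<-trans z≤n t₀<b))
                       (backward (toℕ t₀) (next t) (cong (_+ toℕ t₀) next≡0))))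

-- Induced cycles and their images

neighbours-in-inducedCycle : ∀ {N} {G : Graph N} {S : Subset N} {x y₁ y₂} →
  IsInducedCycle G S → x ∈ S → (∀ z → z ∈ S → Adj G x z → z ≡ y₁ ⊎ z ≡ y₂) →
  y₁ ∈ S × y₂ ∈ S
neighbours-in-inducedCycle {S = S} {y₁ = y₁} {y₂} (k , 3≤k , g , g-inj , g-onto , g-adj) x∈S only-y₁-y₂
  with to (g-onto _) x∈S
... | a , refl = both (neighbour (next a) (CycAdj-next a)) (neighbour (prev a) (CycAdj-prev a))
  where
  g∈S : ∀ i → g i ∈ S
  g∈S i = from (g-onto _) (i , refl)
  neighbour : ∀ i → CycAdj k a i → g i ≡ y₁ ⊎ g i ≡ y₂
  neighbour i adj = only-y₁-y₂ (g i) (g∈S i) (from (g-adj a i) adj)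
  both : g (next a) ≡ y₁ ⊎ g (next a) ≡ y₂ → g (prev a) ≡ y₁ ⊎ g (prev a) ≡ y₂ →
         y₁ ∈ S × y₂ ∈ S
  both (inj₁ e₁) (inj₂ e₂) = subst (_∈ S) e₁ (g∈S (next a)) , subst (_∈ S) e₂ (g∈S (prev a))
  both (inj₂ e₂) (inj₁ e₁) = subst (_∈ S) e₁ (g∈S (prev a)) , subst (_∈ S) e₂ (g∈S (next a))
  both (inj₁ e₁) (inj₁ e₁′) = ⊥-elim (next≢prev 3≤k a (g-inj (trans e₁ (sym e₁′))))
  both (inj₂ e₂) (inj₂ e₂′) = ⊥-elim (next≢prev 3≤k a (g-inj (trans e₂ (sym e₂′))))

-- Walking around T: the S-neighbours of a vertex of S lie among its two T-neighbours,
-- which therefore belong to S.  (Matching 3 ≤ k on s≤s exposes a first vertex g zero of S.)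
inducedCycle-⊆⇒≡ : ∀ {N} {G : Graph N} {S T : Subset N} →
  IsInducedCycle G S → IsInducedCycle G T → S ⊆ T → S ≡ T
inducedCycle-⊆⇒≡ {G = G} {S} {T} cS@(_ , s≤s _ , g , _ , g-onto , _) (l , _ , h , _ , h-onto , h-adj) S⊆T =
  ⊆-antisym S⊆T T⊆S
  where
  Q : Fin l → Set
  Q t = h t ∈ S
  step : ∀ t → Q t → Q (next t)
  step t ht∈S = proj₁ (neighbours-in-inducedCycle {G = G} cS ht∈S only-next-prev)
    where
    only-next-prev : ∀ z → z ∈ S → Adj G (h t) z → z ≡ h (next t) ⊎ z ≡ h (prev t)
    only-next-prev z z∈S adj with to (h-onto z) (S⊆T z∈S)
    ... | s , refl with CycAdj⇒next⊎prev (to (h-adj t s) adj)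
    ...   | inj₁ s≡next = inj₁ (cong h s≡next)
    ...   | inj₂ s≡prev = inj₂ (cong h s≡prev)
  start : ∃ λ t → h t ≡ g zero
  start = to (h-onto (g zero)) (S⊆T (from (g-onto _) (zero , refl)))
  T⊆S : T ⊆ S
  T⊆S x∈T with to (h-onto _) x∈T
  ... | t , refl = next-induction Q step (proj₁ start)
                     (subst (_∈ S) (sym (proj₂ start)) (from (g-onto _) (zero , refl))) t

∈-tabulate : ∀ {n} (f : Fin n → Bool) y → (y ∈ tabulate f) ⇔ (f y ≡ true)
∈-tabulate f y = mk⇔ (λ y∈ → trans (sym (lookup∘tabulate f y)) ([]=⇒lookup y∈))
                     (λ fy → lookup⇒[]= y _ (trans (lookup∘tabulate f y) fy))

image : ∀ {m n} → (Fin m → Fin n) → Subset m → Subset n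
image f S = tabulate λ y → does (any? λ x → (x ∈? S) ×-dec (f x ≟ y))

∈-image : ∀ {m n} (f : Fin m → Fin n) (S : Subset m) y →
          (y ∈ image f S) ⇔ (∃ λ x → x ∈ S × f x ≡ y)
∈-image f S y = mk⇔ witness (λ w → from (∈-tabulate _ y) (dec-true (in-image? y) w))
  where
  in-image? : ∀ y → Dec (∃ λ x → x ∈ S × f x ≡ y)
  in-image? y = any? (λ x → (x ∈? S) ×-dec (f x ≟ y))
  witness : y ∈ image f S → ∃ λ x → x ∈ S × f x ≡ y
  witness y∈ with in-image? y | to (∈-tabulate _ y) y∈
  ... | yes w | _ = w

preimage : ∀ {m n} → (Fin m → Fin n) → Subset n → Subset m
preimage f S = tabulate (λ x → lookup S (f x))

∈-preimage : ∀ {m n} (f : Fin m → Fin n) (S : Subset n) x → (x ∈ preimage f S) ⇔ (f x ∈ S)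
∈-preimage f S x = mk⇔ (λ x∈ → lookup⇒[]= _ S (to (∈-tabulate _ x) x∈))
                       (λ fx∈ → from (∈-tabulate _ x) ([]=⇒lookup fx∈))

WithinRange : ∀ {m n} → (Fin m → Fin n) → Subset n → Set
WithinRange f S = ∀ {y} → y ∈ S → ∃ λ x → f x ≡ y

image-preimage : ∀ {m n} (f : Fin m → Fin n) {S} → WithinRange f S → image f (preimage f S) ≡ S
image-preimage f {S} in-range = ⊆-antisym image⊆ ⊆image
  where
  image⊆ : image f (preimage f S) ⊆ S
  image⊆ y∈ with to (∈-image f _ _) y∈
  ... | x , x∈ , refl = to (∈-preimage f S x) x∈
  ⊆image : S ⊆ image f (preimage f S)
  ⊆image y∈ with in-range y∈
  ... | x , refl = from (∈-image f _ _) (x , from (∈-preimage f S x) y∈ , refl)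

preimage-image : ∀ {m n} {f : Fin m → Fin n} → Injective _≡_ _≡_ f → ∀ S → preimage f (image f S) ≡ S
preimage-image {f = f} f-inj S = ⊆-antisym preimage⊆ ⊆preimage
  where
  preimage⊆ : preimage f (image f S) ⊆ S
  preimage⊆ x∈ with to (∈-image f S _) (to (∈-preimage f _ _) x∈)
  ... | x′ , x′∈ , fx′≡fx = subst (_∈ S) (f-inj fx′≡fx) x′∈
  ⊆preimage : S ⊆ preimage f (image f S)
  ⊆preimage {x} x∈ = from (∈-preimage f _ x) (from (∈-image f S _) (x , x∈ , refl))

image-injective : ∀ {m n} {f : Fin m → Fin n} → Injective _≡_ _≡_ f → Injective _≡_ _≡_ (image f)
image-injective f-inj {S} {T} e =
  trans (sym (preimage-image f-inj S)) (trans (cong (preimage _) e) (preimage-image f-inj T))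

module InducedEmbedding {m n} (G : Graph m) (H : Graph n) (f : Fin m → Fin n)
  (f-inj : Injective _≡_ _≡_ f) (f-adj : ∀ x y → H (f x) (f y) ≡ G x y) where

  inducedCycle-image : ∀ {S} → IsInducedCycle G S → IsInducedCycle H (image f S)
  inducedCycle-image {S} (k , 3≤k , g , g-inj , g-onto , g-adj) =
    k , 3≤k , f ∘ g , g-inj ∘ f-inj , fg-onto , fg-adj
    where
    fg-onto : ∀ y → (y ∈ image f S) ⇔ ∃ (λ i → f (g i) ≡ y)
    fg-onto y = mk⇔
      (λ y∈ → let (x , x∈ , fx≡y) = to (∈-image f S y) y∈
                  (i , gi≡x) = to (g-onto x) x∈
              in i , trans (cong f gi≡x) fx≡y)
      (λ (i , fgi≡y) → from (∈-image f S y) (g i , from (g-onto _) (i , refl) , fgi≡y))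
    fg-adj : ∀ i j → Adj H (f (g i)) (f (g j)) ⇔ CycAdj k i j
    fg-adj i j = mk⇔ (λ adj → to (g-adj i j) (trans (sym (f-adj _ _)) adj))
                     (λ adj → trans (f-adj _ _) (from (g-adj i j) adj))

  inducedCycle-preimage : ∀ {S} → WithinRange f S → IsInducedCycle H S → IsInducedCycle G (preimage f S)
  inducedCycle-preimage {S} in-range (k , 3≤k , g , g-inj , g-onto , g-adj) =
    k , 3≤k , g′ , g′-inj , g′-onto , g′-adj
    where
    lift : ∀ i → ∃ λ x → f x ≡ g i
    lift i = in-range (from (g-onto _) (i , refl))
    g′ : Fin k → Fin m
    g′ = proj₁ ∘ lift
    fg′ : ∀ i → f (g′ i) ≡ g i
    fg′ = proj₂ ∘ lift
    g′-inj : Injective _≡_ _≡_ g′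
    g′-inj {i} {j} e = g-inj (trans (sym (fg′ i)) (trans (cong f e) (fg′ j)))
    g′-onto : ∀ x → (x ∈ preimage f S) ⇔ ∃ (λ i → g′ i ≡ x)
    g′-onto x = mk⇔
      (λ x∈ → let (i , gi≡fx) = to (g-onto _) (to (∈-preimage f S x) x∈)
              in i , f-inj (trans (fg′ i) gi≡fx))
      (λ (i , g′i≡x) → from (∈-preimage f S x)
        (from (g-onto _) (i , trans (sym (fg′ i)) (cong f g′i≡x))))
    g′-adj : ∀ i j → Adj G (g′ i) (g′ j) ⇔ CycAdj k i j
    g′-adj i j = mk⇔
      (λ adj → to (g-adj i j) (trans (sym (cong₂ H (fg′ i) (fg′ j))) (trans (f-adj _ _) adj)))
      (λ adj → trans (sym (f-adj _ _)) (trans (cong₂ H (fg′ i) (fg′ j)) (from (g-adj i j) adj)))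

-- The invariant along the construction of a polygonal 2-tree

CyclomaticFormula : ∀ {n} → Graph n → Set
CyclomaticFormula {n} G = Undirected G × Loopless G ×
  Σ ℕ λ c → NumInducedCycles G c × (edgeCount G + 1 ≡ n + c)

module CycleGraph {n} (G : Graph n) (k : ℕ) (3≤k : 3 ≤ k) (f : Fin k → Fin n)
  (f-inj : Injective _≡_ _≡_ f) (f-onto : ∀ x → (x ∈ ⊤) ⇔ (∃ λ i → f i ≡ x))
  (f-adj : ∀ i j → Adj G (f i) (f j) ⇔ CycAdj k i j) where

  f⁻¹ : ∀ x → ∃ λ i → f i ≡ x
  f⁻¹ x = to (f-onto x) ∈⊤

  π : Permutation k n
  π = mk↔ₛ′ f (proj₁ ∘ f⁻¹) (proj₂ ∘ f⁻¹) (λ i → f-inj (proj₂ (f⁻¹ (f i))))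

  n≡k : n ≡ k
  n≡k = begin
    n             ≡⟨ sym (*-identityʳ n) ⟩
    n * 1         ≡⟨ sym (∑-const n 1) ⟩
    ∑[ x < n ] 1  ≡⟨ ∑-permute (λ _ → 1) π ⟩
    ∑[ i < k ] 1  ≡⟨ ∑-const k 1 ⟩
    k * 1         ≡⟨ *-identityʳ k ⟩
    k             ∎
    where open ≡-Reasoning

  undirected : Undirected G
  undirected x y with f⁻¹ x | f⁻¹ y
  ... | i , refl | j , refl = Bool-ext
    (λ e → from (f-adj j i) (CycAdj-sym (to (f-adj i j) e)))
    (λ e → from (f-adj i j) (CycAdj-sym (to (f-adj j i) e)))
    where
    Bool-ext : ∀ {b c : Bool} → (b ≡ true → c ≡ true) → (c ≡ true → b ≡ true) → b ≡ c
    Bool-ext {false} {false} _ _ = refl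
    Bool-ext {false} {true}  _ c⇒b = c⇒b refl
    Bool-ext {true}  {false} b⇒c _ = sym (b⇒c refl)
    Bool-ext {true}  {true}  _ _ = refl

  loopless : Loopless G
  loopless x with f⁻¹ x
  ... | i , refl with G (f i) (f i) in loop
  ...   | true  = ⊥-elim (CycAdj-irrefl 3≤k (to (f-adj i i) loop))
  ...   | false = refl

  degree≡2 : ∀ i → ∑[ j < k ] 𝟙 (G (f i) (f j)) ≡ 2
  degree≡2 i = ∑-𝟙-two-witnesses (λ j → G (f i) (f j)) (next i) (prev i) (next≢prev 3≤k i)
                 (λ j e → CycAdj⇒next⊎prev (to (f-adj i j) e))
                 (from (f-adj i (next i)) (CycAdj-next i)) (from (f-adj i (prev i)) (CycAdj-prev i))

  edgeCount≡n : edgeCount G ≡ n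
  edgeCount≡n = edgeCount-from-degreeSum G undirected loopless (begin
    degreeSum G                                ≡⟨ degreeSum-permute G π ⟩
    ∑[ i < k ] ∑[ j < k ] 𝟙 (G (f i) (f j))    ≡⟨ sum-cong-≗ degree≡2 ⟩
    ∑[ i < k ] 2                               ≡⟨ ∑-const k 2 ⟩
    k * 2                                      ≡⟨ *-comm k 2 ⟩
    k + (k + 0)                                ≡⟨ cong (λ m → m + (m + 0)) (sym n≡k) ⟩
    n + (n + 0)                                ≡⟨ cong (n +_) (+-identityʳ n) ⟩
    n + n                                      ∎)
    where open ≡-Reasoning

cycleGraph-formula : ∀ {n} (G : Graph n) → IsCycleGraph G → CyclomaticFormula G
cycleGraph-formula G cycleG@(k , 3≤k , f , f-inj , f-onto , f-adj) =
  undirected , loopless , 1 ,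
  ((⊤ ∷ []) , ([] ∷ []) , (cycleG ∷ []) , only-⊤ , refl) , cong (_+ 1) edgeCount≡n
  where
  open CycleGraph G k 3≤k f f-inj f-onto f-adj
  only-⊤ : ∀ S → IsInducedCycle G S → S List.∈ (⊤ ∷ [])
  only-⊤ S cycleS = here (inducedCycle-⊆⇒≡ {G = G} cycleS cycleG (λ _ → ∈⊤))

≅-formula : ∀ {n} (G H : Graph n) → G ≅ H → CyclomaticFormula G → CyclomaticFormula H
≅-formula {n} G H (σ , hom)
  (undirectedG , looplessG , c , (L , unique , cycles , complete , length≡c) , formula) =
  undirectedH , looplessH , c ,
  (map (image (σ ⟨$⟩ʳ_)) L , Unique.map⁺ (image-injective σ-inj) unique ,
   All.gmap⁺ inducedCycle-image cycles , complete′ , trans (length-map _ L) length≡c) ,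
  trans (cong (_+ 1) edgeCount≡) formula
  where
  σ-inj : Injective _≡_ _≡_ (σ ⟨$⟩ʳ_)
  σ-inj e = trans (sym (inverseˡ σ)) (trans (cong (σ ⟨$⟩ˡ_) e) (inverseˡ σ))
  open InducedEmbedding G H (σ ⟨$⟩ʳ_) σ-inj hom
  σ-onto : ∀ {S} → WithinRange (σ ⟨$⟩ʳ_) S
  σ-onto {y = y} _ = σ ⟨$⟩ˡ y , inverseʳ σ
  hom⁻¹ : ∀ x y → H x y ≡ G (σ ⟨$⟩ˡ x) (σ ⟨$⟩ˡ y)
  hom⁻¹ x y = trans (sym (cong₂ H (inverseʳ σ) (inverseʳ σ))) (hom _ _)
  undirectedH : Undirected H
  undirectedH x y = trans (hom⁻¹ x y) (trans (undirectedG _ _) (sym (hom⁻¹ y x)))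
  looplessH : Loopless H
  looplessH x = trans (hom⁻¹ x x) (looplessG _)
  edgeCount≡ : edgeCount H ≡ edgeCount G
  edgeCount≡ = edgeCount-from-degreeSum H undirectedH looplessH (begin
    degreeSum H                                          ≡⟨ degreeSum-permute H σ ⟩
    ∑[ i < n ] ∑[ j < n ] 𝟙 (H (σ ⟨$⟩ʳ i) (σ ⟨$⟩ʳ j))
      ≡⟨ sum-cong-≗ (λ i → sum-cong-≗ (cong 𝟙 ∘ hom i)) ⟩
    degreeSum G                                          ≡⟨ handshake G undirectedG looplessG ⟩
    edgeCount G + edgeCount G                            ∎)
    where open ≡-Reasoning
  complete′ : ∀ S → IsInducedCycle H S → S List.∈ map (image (σ ⟨$⟩ʳ_)) L
  complete′ S cycleS = subst (List._∈ map (image (σ ⟨$⟩ʳ_)) L) (image-preimage _ σ-onto)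
    (List.∈-map⁺ (image (σ ⟨$⟩ʳ_)) (complete _ (inducedCycle-preimage σ-onto cycleS)))

data Split (m l : ℕ) : Fin (m + l) → Set where
  left  : (a : Fin m) → Split m l (a ↑ˡ l)
  right : (k : Fin l) → Split m l (m ↑ʳ k)

split : ∀ m {l} (x : Fin (m + l)) → Split m l x
split m {l} x with splitAt m x in e
... | inj₁ a = subst (Split m l) (splitAt⁻¹-↑ˡ e) (left a)
... | inj₂ k = subst (Split m l) (splitAt⁻¹-↑ʳ e) (right k)

↑ˡ≢↑ʳ : ∀ {m l} (a : Fin m) (k : Fin l) → a ↑ˡ l ≢ m ↑ʳ k
↑ˡ≢↑ʳ {m} {l} a k e with trans (sym (splitAt-↑ˡ m a l)) (trans (cong (splitAt m) e) (splitAt-↑ʳ m l k))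
... | ()

module AddPath {n} (G : Graph n) (u v : Fin n) (p : ℕ)
  (undirected : Undirected G) (loopless : Loopless G) (u~v : Adj G u v) where

  G′ : Graph (n + suc p)
  G′ = addPath G u v p

  old : Fin n → Fin (n + suc p)
  old a = a ↑ˡ suc p

  new : Fin (suc p) → Fin (n + suc p)
  new k = n ↑ʳ k

  attached : Fin n → Fin (suc p) → Bool
  attached a k = ((toℕ a ≡ᵇ toℕ u) ∧ (toℕ k ≡ᵇ 0)) ∨ ((toℕ a ≡ᵇ toℕ v) ∧ (toℕ k ≡ᵇ p))

  consecutive : Fin (suc p) → Fin (suc p) → Bool
  consecutive k l = (suc (toℕ k) ≡ᵇ toℕ l) ∨ (suc (toℕ l) ≡ᵇ toℕ k)

  G′-old-old : ∀ a b → G′ (old a) (old b) ≡ G a b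
  G′-old-old a b rewrite splitAt-↑ˡ n a (suc p) | splitAt-↑ˡ n b (suc p) = refl

  G′-old-new : ∀ a k → G′ (old a) (new k) ≡ attached a k
  G′-old-new a k rewrite splitAt-↑ˡ n a (suc p) | splitAt-↑ʳ n (suc p) k = refl

  G′-new-old : ∀ k a → G′ (new k) (old a) ≡ attached a k
  G′-new-old k a rewrite splitAt-↑ˡ n a (suc p) | splitAt-↑ʳ n (suc p) k = refl

  G′-new-new : ∀ k l → G′ (new k) (new l) ≡ consecutive k l
  G′-new-new k l rewrite splitAt-↑ʳ n (suc p) k | splitAt-↑ʳ n (suc p) l = refl

  u≢v : u ≢ v
  u≢v refl with trans (sym u~v) (loopless u)
  ... | ()

  undirected′ : Undirected G′
  undirected′ x y with split n x | split n y
  ... | left a  | left b  = trans (G′-old-old a b) (trans (undirected a b) (sym (G′-old-old b a)))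
  ... | left a  | right l = trans (G′-old-new a l) (sym (G′-new-old l a))
  ... | right k | left b  = trans (G′-new-old k b) (sym (G′-old-new b k))
  ... | right k | right l =
    trans (G′-new-new k l) (trans (∨-comm (suc (toℕ k) ≡ᵇ toℕ l) _) (sym (G′-new-new l k)))

  loopless′ : Loopless G′
  loopless′ x with split n x
  ... | left a  = trans (G′-old-old a a) (loopless a)
  ... | right k = trans (G′-new-new k k) (cong (λ b → b ∨ b) (≢⇒≡ᵇ-false (1+n≢n {toℕ k})))

  ∑-attached : ∀ a → ∑[ l < suc p ] 𝟙 (attached a l) ≡
                     𝟙 (toℕ a ≡ᵇ toℕ u) + 𝟙 (toℕ a ≡ᵇ toℕ v)
  ∑-attached a with toℕ a ≡ᵇ toℕ u in a≡u | toℕ a ≡ᵇ toℕ v in a≡v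
  ... | true  | true  =
    ⊥-elim (u≢v (toℕ-injective (trans (sym (≡ᵇ-true⇒≡ {toℕ a} a≡u)) (≡ᵇ-true⇒≡ {toℕ a} a≡v))))
  ... | true  | false =
    trans (sum-cong-≗ {suc p} (λ l → cong 𝟙 (∨-identityʳ (toℕ l ≡ᵇ 0)))) (∑-𝟙-toℕ-≡ᵇ {suc p} zero)
  ... | false | true  =
    trans (sum-cong-≗ {suc p} (λ l → cong (λ q → 𝟙 (toℕ l ≡ᵇ q)) (sym (toℕ-fromℕ p))))
          (∑-𝟙-toℕ-≡ᵇ (fromℕ p))
  ... | false | false = sum-replicate-zero (suc p)

  ∑∑-attached : ∑[ a < n ] ∑[ l < suc p ] 𝟙 (attached a l) ≡ 2
  ∑∑-attached = trans (sum-cong-≗ {n} ∑-attached)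
    (trans (∑-distrib-+ {n} (λ a → 𝟙 (toℕ a ≡ᵇ toℕ u)) (λ a → 𝟙 (toℕ a ≡ᵇ toℕ v)))
           (cong₂ _+_ (∑-𝟙-toℕ-≡ᵇ u) (∑-𝟙-toℕ-≡ᵇ v)))

  𝟙-consecutive : ∀ k l → 𝟙 (consecutive k l) ≡
                          𝟙 (suc (toℕ k) ≡ᵇ toℕ l) + 𝟙 (suc (toℕ l) ≡ᵇ toℕ k)
  𝟙-consecutive k l with suc (toℕ k) ≡ᵇ toℕ l in k→l | suc (toℕ l) ≡ᵇ toℕ k in l→k
  ... | true  | true  = ⊥-elim (<-irrefl (sym k+2≡k) (m≤n⇒m≤1+n (n<1+n _)))
    where
    k+2≡k : suc (suc (toℕ k)) ≡ toℕ k
    k+2≡k = trans (cong suc (≡ᵇ-true⇒≡ {suc (toℕ k)} k→l)) (≡ᵇ-true⇒≡ {suc (toℕ l)} l→k)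
  ... | true  | false = refl
  ... | false | true  = refl
  ... | false | false = refl

  ∑∑-successor : ∑[ k < suc p ] ∑[ l < suc p ] 𝟙 (suc (toℕ k) ≡ᵇ toℕ l) ≡ p
  ∑∑-successor = trans (sum-cong-≗ {suc p} (λ k → ∑-𝟙-≡ᵇ-toℕ (suc (toℕ k)) (suc p)))
                       (trans (∑-𝟙-<ᵇ (suc p) p) (m≥n⇒m⊓n≡n (n≤1+n p)))

  ∑∑-consecutive : ∑[ k < suc p ] ∑[ l < suc p ] 𝟙 (consecutive k l) ≡ p + p
  ∑∑-consecutive = begin
    ∑[ k < suc p ] ∑[ l < suc p ] 𝟙 (consecutive k l)
      ≡⟨ sum-cong-≗ {suc p} (λ k → trans (sum-cong-≗ {suc p} (𝟙-consecutive k))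
                                         (∑-distrib-+ {suc p} (k→ k) (→k k))) ⟩
    ∑[ k < suc p ] (∑[ l < suc p ] k→ k l + ∑[ l < suc p ] →k k l)
      ≡⟨ ∑-distrib-+ {suc p} (λ k → ∑[ l < suc p ] k→ k l) (λ k → ∑[ l < suc p ] →k k l) ⟩
    ∑[ k < suc p ] ∑[ l < suc p ] k→ k l + ∑[ k < suc p ] ∑[ l < suc p ] →k k l
      ≡⟨ cong₂ _+_ ∑∑-successor (trans (∑-comm {suc p} {suc p} →k) ∑∑-successor) ⟩
    p + p ∎
    where
    open ≡-Reasoning
    k→ →k : Fin (suc p) → Fin (suc p) → ℕ
    k→ k l = 𝟙 (suc (toℕ k) ≡ᵇ toℕ l)
    →k k l = 𝟙 (suc (toℕ l) ≡ᵇ toℕ k)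

  degreeSum-G′ : degreeSum G′ ≡ (degreeSum G + 2) + (2 + (p + p))
  degreeSum-G′ = begin
    degreeSum G′
      ≡⟨ ∑-↑ n (suc p) (λ x → ∑[ y < n + suc p ] 𝟙 (G′ x y)) ⟩
    ∑[ a < n ] ∑[ y < n + suc p ] 𝟙 (G′ (old a) y)
      + ∑[ k < suc p ] ∑[ y < n + suc p ] 𝟙 (G′ (new k) y)
      ≡⟨ cong₂ _+_ (sum-cong-≗ {n} (λ a → ∑-↑ n (suc p) (𝟙 ∘ G′ (old a))))
                   (sum-cong-≗ {suc p} (λ k → ∑-↑ n (suc p) (𝟙 ∘ G′ (new k)))) ⟩
    ∑[ a < n ] (∑[ b < n ] 𝟙 (G′ (old a) (old b)) + ∑[ l < suc p ] 𝟙 (G′ (old a) (new l)))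
      + ∑[ k < suc p ] (∑[ b < n ] 𝟙 (G′ (new k) (old b)) + ∑[ l < suc p ] 𝟙 (G′ (new k) (new l)))
      ≡⟨ cong₂ _+_
           (sum-cong-≗ {n} (λ a → cong₂ _+_ (sum-cong-≗ {n} (cong 𝟙 ∘ G′-old-old a))
                                            (sum-cong-≗ {suc p} (cong 𝟙 ∘ G′-old-new a))))
           (sum-cong-≗ {suc p} (λ k → cong₂ _+_ (sum-cong-≗ {n} (cong 𝟙 ∘ G′-new-old k))
                                                (sum-cong-≗ {suc p} (cong 𝟙 ∘ G′-new-new k)))) ⟩
    ∑[ a < n ] (∑[ b < n ] 𝟙 (G a b) + ∑[ l < suc p ] 𝟙 (attached a l))
      + ∑[ k < suc p ] (∑[ b < n ] 𝟙 (attached b k) + ∑[ l < suc p ] 𝟙 (consecutive k l))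
      ≡⟨ cong₂ _+_ (∑-distrib-+ {n} (λ a → ∑[ b < n ] 𝟙 (G a b))
                                    (λ a → ∑[ l < suc p ] 𝟙 (attached a l)))
                   (∑-distrib-+ {suc p} (λ k → ∑[ b < n ] 𝟙 (attached b k))
                                        (λ k → ∑[ l < suc p ] 𝟙 (consecutive k l))) ⟩
    (degreeSum G + ∑[ a < n ] ∑[ l < suc p ] 𝟙 (attached a l))
      + (∑[ k < suc p ] ∑[ b < n ] 𝟙 (attached b k) + ∑[ k < suc p ] ∑[ l < suc p ] 𝟙 (consecutive k l))
      ≡⟨ cong₂ _+_ (cong (degreeSum G +_) ∑∑-attached)
                   (cong₂ _+_ (trans (sym (∑-comm (λ b k → 𝟙 (attached b k)))) ∑∑-attached)
                              ∑∑-consecutive) ⟩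
    (degreeSum G + 2) + (2 + (p + p)) ∎
    where open ≡-Reasoning

  edgeCount-G′ : edgeCount G′ ≡ edgeCount G + (2 + p)
  edgeCount-G′ = edgeCount-from-degreeSum G′ undirected′ loopless′ (begin
    degreeSum G′
      ≡⟨ degreeSum-G′ ⟩
    (degreeSum G + 2) + (2 + (p + p))
      ≡⟨ cong (λ d → (d + 2) + (2 + (p + p))) (handshake G undirected loopless) ⟩
    ((edgeCount G + edgeCount G) + 2) + (2 + (p + p))
      ≡⟨ regroup (edgeCount G) p ⟩
    (edgeCount G + (2 + p)) + (edgeCount G + (2 + p)) ∎)
    where
    open ≡-Reasoning
    open +-*-Solver using (solve; _:+_; con; _:=_)
    regroup : ∀ e p → ((e + e) + 2) + (2 + (p + p)) ≡ (e + (2 + p)) + (e + (2 + p))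
    regroup = solve 2 (λ e p → ((e :+ e) :+ con 2) :+ (con 2 :+ (p :+ p))
                            := (e :+ (con 2 :+ p)) :+ (e :+ (con 2 :+ p))) refl

  ends : Fin 2 → Fin (n + suc p)
  ends zero       = old v
  ends (suc zero) = old u

  -- The closed path, in cyclic order: positions 0 … p are the new vertices, then v, then u.
  pathVertex : Fin (suc p + 2) → Fin (n + suc p)
  pathVertex t = [ new , ends ]′ (splitAt (suc p) t)

  pathVertex-new : ∀ k → pathVertex (k ↑ˡ 2) ≡ new k
  pathVertex-new k rewrite splitAt-↑ˡ (suc p) k 2 = refl

  pathVertex-end : ∀ r → pathVertex (suc p ↑ʳ r) ≡ ends r
  pathVertex-end r rewrite splitAt-↑ʳ (suc p) 2 r = refl

  posᵛ posᵘ : Fin (suc p + 2)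
  posᵛ = suc p ↑ʳ zero
  posᵘ = suc p ↑ʳ suc zero

  toℕ-v : toℕ posᵛ ≡ suc p
  toℕ-v = trans (toℕ-↑ʳ (suc p) zero) (+-identityʳ (suc p))

  toℕ-u : toℕ posᵘ ≡ suc (suc p)
  toℕ-u = trans (toℕ-↑ʳ (suc p) (suc zero)) (+-comm (suc p) 1)

  old-injective : ∀ {a b} → old a ≡ old b → a ≡ b
  old-injective = ↑ˡ-injective (suc p) _ _

  pathVertex-injective : ∀ {s t} → pathVertex s ≡ pathVertex t → s ≡ t
  pathVertex-injective {s} {t} e with split (suc p) s | split (suc p) t
  ... | left k | left l =
    cong (_↑ˡ 2) (↑ʳ-injective n k l (trans (sym (pathVertex-new k)) (trans e (pathVertex-new l))))
  ... | left k | right r = ⊥-elim (new≢end k r (trans (sym (pathVertex-new k)) (trans e (pathVertex-end r))))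
    where
    new≢end : ∀ k r → new k ≢ ends r
    new≢end k zero       = ↑ˡ≢↑ʳ v k ∘ sym
    new≢end k (suc zero) = ↑ˡ≢↑ʳ u k ∘ sym
  ... | right r | left l = ⊥-elim (end≢new r l (trans (sym (pathVertex-end r)) (trans e (pathVertex-new l))))
    where
    end≢new : ∀ r l → ends r ≢ new l
    end≢new zero       = ↑ˡ≢↑ʳ v
    end≢new (suc zero) = ↑ˡ≢↑ʳ u
  ... | right r | right r′ =
    cong (suc p ↑ʳ_) (ends-injective r r′ (trans (sym (pathVertex-end r)) (trans e (pathVertex-end r′))))
    where
    ends-injective : ∀ r r′ → ends r ≡ ends r′ → r ≡ r′
    ends-injective zero       zero       _ = refl
    ends-injective (suc zero) (suc zero) _ = refl
    ends-injective zero       (suc zero) e = ⊥-elim (u≢v (sym (old-injective e)))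
    ends-injective (suc zero) zero       e = ⊥-elim (u≢v (old-injective e))

  -- CycAdj k i j unfolds to CycAdjℕ k (toℕ i) (toℕ j); stating it for the length 3 + p
  -- lets the arithmetic below compute.
  CycAdjℕ : ℕ → ℕ → ℕ → Set
  CycAdjℕ k x y = (suc x ≡ y) ⊎ (suc y ≡ x) ⊎ ((suc x ≡ k) × (y ≡ 0)) ⊎ ((suc y ≡ k) × (x ≡ 0))

  beyond : ∀ (k : Fin (suc p)) {m} → p < m → toℕ k ≢ m
  beyond k p<m k≡m = <⇒≱ p<m (subst (_≤ p) k≡m (≤-pred (toℕ<n k)))

  p<2+p : p < 2 + p
  p<2+p = n≤1+n (suc p)

  adj-new-new : ∀ k l → (consecutive k l ≡ true) ⇔ CycAdjℕ (3 + p) (toℕ k) (toℕ l)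
  adj-new-new k l = mk⇔ to′ from′
    where
    to′ : consecutive k l ≡ true → CycAdjℕ (3 + p) (toℕ k) (toℕ l)
    to′ e with suc (toℕ k) ≡ᵇ toℕ l in k→l
    ... | true  = inj₁ (≡ᵇ-true⇒≡ k→l)
    ... | false = inj₂ (inj₁ (≡ᵇ-true⇒≡ e))
    from′ : CycAdjℕ (3 + p) (toℕ k) (toℕ l) → consecutive k l ≡ true
    from′ (inj₁ k→l) rewrite ≡⇒≡ᵇ-true k→l = refl
    from′ (inj₂ (inj₁ l→k)) rewrite ≡⇒≡ᵇ-true l→k = ∨-zeroʳ _
    from′ (inj₂ (inj₂ (inj₁ (k+1≡3+p , _)))) = ⊥-elim (beyond k p<2+p (suc-injective k+1≡3+p))
    from′ (inj₂ (inj₂ (inj₂ (l+1≡3+p , _)))) = ⊥-elim (beyond l p<2+p (suc-injective l+1≡3+p))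

  adj-new-v : ∀ k → (attached v k ≡ true) ⇔ CycAdjℕ (3 + p) (toℕ k) (suc p)
  adj-new-v k = mk⇔ to′ from′
    where
    attached-v : attached v k ≡ (toℕ k ≡ᵇ p)
    attached-v rewrite ≢⇒≡ᵇ-false (u≢v ∘ sym ∘ toℕ-injective) | ≡⇒≡ᵇ-true (refl {x = toℕ v}) = refl
    to′ : attached v k ≡ true → CycAdjℕ (3 + p) (toℕ k) (suc p)
    to′ e = inj₁ (cong suc (≡ᵇ-true⇒≡ (trans (sym attached-v) e)))
    from′ : CycAdjℕ (3 + p) (toℕ k) (suc p) → attached v k ≡ true
    from′ (inj₁ k+1≡p+1) = trans attached-v (≡⇒≡ᵇ-true (suc-injective k+1≡p+1))
    from′ (inj₂ (inj₁ p+2≡k)) = ⊥-elim (beyond k p<2+p (sym p+2≡k))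
    from′ (inj₂ (inj₂ (inj₁ (k+1≡3+p , _)))) = ⊥-elim (beyond k p<2+p (suc-injective k+1≡3+p))
    from′ (inj₂ (inj₂ (inj₂ (p+2≡3+p , _)))) = ⊥-elim (1+n≢n (sym p+2≡3+p))

  adj-new-u : ∀ k → (attached u k ≡ true) ⇔ CycAdjℕ (3 + p) (toℕ k) (suc (suc p))
  adj-new-u k = mk⇔ to′ from′
    where
    attached-u : attached u k ≡ (toℕ k ≡ᵇ 0)
    attached-u rewrite ≡⇒≡ᵇ-true (refl {x = toℕ u}) | ≢⇒≡ᵇ-false (u≢v ∘ toℕ-injective) = ∨-identityʳ _
    to′ : attached u k ≡ true → CycAdjℕ (3 + p) (toℕ k) (suc (suc p))
    to′ e = inj₂ (inj₂ (inj₂ (refl , ≡ᵇ-true⇒≡ (trans (sym attached-u) e))))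
    from′ : CycAdjℕ (3 + p) (toℕ k) (suc (suc p)) → attached u k ≡ true
    from′ (inj₁ k+1≡p+2) = ⊥-elim (beyond k (n<1+n _) (suc-injective k+1≡p+2))
    from′ (inj₂ (inj₁ p+3≡k)) = ⊥-elim (beyond k (≤-trans (n≤1+n _) (n≤1+n _)) (sym p+3≡k))
    from′ (inj₂ (inj₂ (inj₁ (k+1≡3+p , _)))) = ⊥-elim (beyond k p<2+p (suc-injective k+1≡3+p))
    from′ (inj₂ (inj₂ (inj₂ (_ , k≡0)))) = trans attached-u (≡⇒≡ᵇ-true k≡0)

  adj-v-u : (G v u ≡ true) ⇔ CycAdjℕ (3 + p) (suc p) (suc (suc p))
  adj-v-u = mk⇔ (λ _ → inj₁ refl) (λ _ → trans (undirected v u) u~v)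

  cycleLength : ℕ
  cycleLength = suc p + 2

  3≤cycleLength : 3 ≤ cycleLength
  3≤cycleLength = s≤s (m≤n+m 2 p)

  adj-via-ℕ : ∀ {s t x y a b β} → pathVertex s ≡ x → pathVertex t ≡ y → toℕ s ≡ a → toℕ t ≡ b →
              G′ x y ≡ β → (β ≡ true) ⇔ CycAdjℕ (3 + p) a b →
              Adj G′ (pathVertex s) (pathVertex t) ⇔ CycAdj cycleLength s t
  adj-via-ℕ {s} {t} refl refl refl refl refl adj =
    subst (λ K → Adj G′ (pathVertex s) (pathVertex t) ⇔ CycAdjℕ K (toℕ s) (toℕ t))
          (cong suc (+-comm 2 p)) adj

  adj-flip : ∀ {s t} → Adj G′ (pathVertex t) (pathVertex s) ⇔ CycAdj cycleLength t s →
             Adj G′ (pathVertex s) (pathVertex t) ⇔ CycAdj cycleLength s t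
  adj-flip {s} {t} adj = mk⇔ (λ e → CycAdj-sym (to adj (trans (undirected′ _ _) e)))
                             (λ c → trans (undirected′ _ _) (from adj (CycAdj-sym c)))

  adj-loop : ∀ t → Adj G′ (pathVertex t) (pathVertex t) ⇔ CycAdj cycleLength t t
  adj-loop t = mk⇔ (λ e → ⊥-elim (true≢false (trans (sym e) (loopless′ _))))
                   (λ c → ⊥-elim (CycAdj-irrefl 3≤cycleLength c))
    where
    true≢false : true ≢ false
    true≢false ()

  pathAdj-new-new : ∀ k l → Adj G′ (pathVertex (k ↑ˡ 2)) (pathVertex (l ↑ˡ 2)) ⇔ CycAdj cycleLength (k ↑ˡ 2) (l ↑ˡ 2)
  pathAdj-new-new k l = adj-via-ℕ (pathVertex-new k) (pathVertex-new l) (toℕ-↑ˡ k 2) (toℕ-↑ˡ l 2)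
                                  (G′-new-new k l) (adj-new-new k l)

  pathAdj-new-v : ∀ k → Adj G′ (pathVertex (k ↑ˡ 2)) (pathVertex posᵛ) ⇔ CycAdj cycleLength (k ↑ˡ 2) posᵛ
  pathAdj-new-v k = adj-via-ℕ (pathVertex-new k) (pathVertex-end zero) (toℕ-↑ˡ k 2) toℕ-v
                              (G′-new-old k v) (adj-new-v k)

  pathAdj-new-u : ∀ k → Adj G′ (pathVertex (k ↑ˡ 2)) (pathVertex posᵘ) ⇔ CycAdj cycleLength (k ↑ˡ 2) posᵘ
  pathAdj-new-u k = adj-via-ℕ (pathVertex-new k) (pathVertex-end (suc zero)) (toℕ-↑ˡ k 2) toℕ-u
                              (G′-new-old k u) (adj-new-u k)

  pathAdj-v-u : Adj G′ (pathVertex posᵛ) (pathVertex posᵘ) ⇔ CycAdj cycleLength posᵛ posᵘ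
  pathAdj-v-u = adj-via-ℕ (pathVertex-end zero) (pathVertex-end (suc zero)) toℕ-v toℕ-u
                          (G′-old-old v u) adj-v-u

  pathVertex-adj : ∀ s t → Adj G′ (pathVertex s) (pathVertex t) ⇔ CycAdj cycleLength s t
  pathVertex-adj s t with split (suc p) s | split (suc p) t
  ... | left k           | left l           = pathAdj-new-new k l
  ... | left k           | right zero       = pathAdj-new-v k
  ... | left k           | right (suc zero) = pathAdj-new-u k
  ... | right zero       | left l           = adj-flip (pathAdj-new-v l)
  ... | right (suc zero) | left l           = adj-flip (pathAdj-new-u l)
  ... | right zero       | right (suc zero) = pathAdj-v-u
  ... | right (suc zero) | right zero       = adj-flip pathAdj-v-u
  ... | right zero       | right zero       = adj-loop posᵛ
  ... | right (suc zero) | right (suc zero) = adj-loop posᵘ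

  pathCycle : Subset (n + suc p)
  pathCycle = image pathVertex ⊤

  new∈pathCycle : ∀ k → new k ∈ pathCycle
  new∈pathCycle k = from (∈-image pathVertex ⊤ _) (k ↑ˡ 2 , ∈⊤ , pathVertex-new k)

  pathCycle-inducedCycle : IsInducedCycle G′ pathCycle
  pathCycle-inducedCycle = cycleLength , 3≤cycleLength , pathVertex , pathVertex-injective , onto , pathVertex-adj
    where
    onto : ∀ x → (x ∈ pathCycle) ⇔ ∃ λ t → pathVertex t ≡ x
    onto x = mk⇔ (λ x∈ → let (t , _ , e) = to (∈-image pathVertex ⊤ x) x∈ in t , e)
                 (λ (t , e) → from (∈-image pathVertex ⊤ x) (t , ∈⊤ , e))

  neighbour-of-new-on-path : ∀ k z → Adj G′ (new k) z → ∃ λ t → pathVertex t ≡ z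
  neighbour-of-new-on-path k z adj with split n z
  ... | right l = l ↑ˡ 2 , pathVertex-new l
  ... | left a with to T-∨ (from T-≡ (trans (sym (G′-new-old k a)) adj))
  ...   | inj₁ at-u = suc p ↑ʳ suc zero , trans (pathVertex-end (suc zero)) (cong old (sym (toℕ-injective
                        (≡ᵇ⇒≡ (toℕ a) (toℕ u) (proj₁ (to T-∧ at-u))))))
  ...   | inj₂ at-v = suc p ↑ʳ zero , trans (pathVertex-end zero) (cong old (sym (toℕ-injective
                        (≡ᵇ⇒≡ (toℕ a) (toℕ v) (proj₁ (to T-∧ at-v))))))

  interior-neighbours : ∀ t → toℕ t < suc p → ∀ z → Adj G′ (pathVertex t) z →
                        z ≡ pathVertex (next t) ⊎ z ≡ pathVertex (prev t)
  interior-neighbours t t<p+1 z adj with split (suc p) t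
  ... | right r = ⊥-elim (m+n≮m (suc p) (toℕ r) (subst (_< suc p) (toℕ-↑ʳ (suc p) r) t<p+1))
  ... | left k with neighbour-of-new-on-path k z (subst (λ x → Adj G′ x z) (pathVertex-new k) adj)
  ...   | s , refl with CycAdj⇒next⊎prev (to (pathVertex-adj (k ↑ˡ 2) s) adj)
  ...     | inj₁ s≡next = inj₁ (cong pathVertex s≡next)
  ...     | inj₂ s≡prev = inj₂ (cong pathVertex s≡prev)

  inducedCycle-through-new≡pathCycle : ∀ {S k} → IsInducedCycle G′ S → new k ∈ S → S ≡ pathCycle
  inducedCycle-through-new≡pathCycle {S} {k} cycleS new∈S =
    sym (inducedCycle-⊆⇒≡ {G = G′} pathCycle-inducedCycle cycleS pathCycle⊆S)
    where
    on-S : ∀ t → pathVertex t ∈ S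
    on-S = arc-induction (λ t → pathVertex t ∈ S)
      (λ t t<p+1 t∈S →
         neighbours-in-inducedCycle {G = G′} cycleS t∈S (λ z _ → interior-neighbours t t<p+1 z))
      (k ↑ˡ 2) (subst (_< suc p) (sym (toℕ-↑ˡ k 2)) (toℕ<n k))
      (subst (_∈ S) (sym (pathVertex-new k)) new∈S)
    pathCycle⊆S : pathCycle ⊆ S
    pathCycle⊆S x∈ with to (∈-image pathVertex ⊤ _) x∈
    ... | t , _ , refl = on-S t

addPath-formula : ∀ {n} (G : Graph n) (u v : Fin n) (p : ℕ) → Adj G u v →
                  CyclomaticFormula G → CyclomaticFormula (addPath G u v p)
addPath-formula {n} G u v p u~v
  (undirected , loopless , c , (L , unique , cycles , complete , length≡c) , formula) =
  undirected′ , loopless′ , suc c ,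
  (pathCycle ∷ map (image old) L , unique′ ,
   pathCycle-inducedCycle ∷ All.gmap⁺ inducedCycle-image cycles ,
   complete′ , cong suc (trans (length-map _ L) length≡c)) ,
  formula′
  where
  open AddPath G u v p undirected loopless u~v
  open InducedEmbedding G G′ old old-injective G′-old-old

  pathCycle≢image-old : ∀ S → pathCycle ≢ image old S
  pathCycle≢image-old S e with to (∈-image old S (new zero)) (subst (new zero ∈_) e (new∈pathCycle zero))
  ... | a , _ , old≡new = ↑ˡ≢↑ʳ a zero old≡new

  unique′ : Unique (pathCycle ∷ map (image old) L)
  unique′ = All.map⁺ (All.tabulate (λ {S} _ → pathCycle≢image-old S))
          ∷ Unique.map⁺ (image-injective old-injective) unique

  complete′ : ∀ S → IsInducedCycle G′ S → S List.∈ (pathCycle ∷ map (image old) L)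
  complete′ S cycleS with any? (λ k → new k ∈? S)
  ... | yes (k , new∈S) = here (inducedCycle-through-new≡pathCycle cycleS new∈S)
  ... | no no-new = there (subst (List._∈ map (image old) L) (image-preimage old in-range)
                                 (List.∈-map⁺ (image old) (complete _ (inducedCycle-preimage in-range cycleS))))
    where
    in-range : WithinRange old S
    in-range {y} y∈S with split n y
    ... | left a  = a , refl
    ... | right k = ⊥-elim (no-new (k , y∈S))

  formula′ : edgeCount G′ + 1 ≡ (n + suc p) + suc c
  formula′ = begin
    edgeCount G′ + 1            ≡⟨ cong (_+ 1) edgeCount-G′ ⟩
    (edgeCount G + (2 + p)) + 1 ≡⟨ regroup₁ (edgeCount G) p ⟩
    (edgeCount G + 1) + (2 + p) ≡⟨ cong (_+ (2 + p)) formula ⟩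
    (n + c) + (2 + p)           ≡⟨ regroup₂ n c p ⟩
    (n + suc p) + suc c         ∎
    where
    open ≡-Reasoning
    open +-*-Solver using (solve; _:+_; con; _:=_)
    regroup₁ : ∀ e p → (e + (2 + p)) + 1 ≡ (e + 1) + (2 + p)
    regroup₁ = solve 2 (λ e p → (e :+ (con 2 :+ p)) :+ con 1 := (e :+ con 1) :+ (con 2 :+ p)) refl
    regroup₂ : ∀ n c p → (n + c) + (2 + p) ≡ (n + (1 + p)) + (1 + c)
    regroup₂ = solve 3 (λ n c p → (n :+ c) :+ (con 2 :+ p) := (n :+ (con 1 :+ p)) :+ (con 1 :+ c)) refl

polygonal2Tree-formula : ∀ {n} (G : Graph n) → Polygonal2Tree G → CyclomaticFormula G
polygonal2Tree-formula G (cycle .G cycleG) = cycleGraph-formula G cycleG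
polygonal2Tree-formula .(addPath G u v p) (path G u v p tree u~v) =
  addPath-formula G u v p u~v (polygonal2Tree-formula G tree)
polygonal2Tree-formula H (iso G .H tree G≅H) = ≅-formula G H G≅H (polygonal2Tree-formula G tree)

lemma19 : ∀ (n : ℕ) (G : Graph n) → Polygonal2Tree G →
            NumInducedCycles G (edgeCount G + 1 ∸ n)
lemma19 n G tree with polygonal2Tree-formula G tree
... | _ , _ , c , cycles , formula =
  subst (NumInducedCycles G) (sym (trans (cong (_∸ n) formula) (m+n∸m≡n n c))) cycles
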